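{- Let $G=(V,E)$ be a planar graph with a fixed combinatorial embedding in which every vertex has degree at most $3$, and let $s,t\in V$ be distinct vertices with $st\notin E$. Then every shortest $st$-path in the extended dual $G^\star_{st}$ of $G$ is consistent.
   Context: The combinatorial embedding of $G$ is fixed (only the choice of the outer face is free). The extended dual $G^\star_{st}$ is the dual graph $G^\star$ of the embedded graph $G$ together with two additional vertices $s$ and $t$, where $s$ (resp. $t$) is joined by an edge to the dual vertex of every face of $G$ incident to $s$ (resp. $t$); it inherits an embedding from that of $G$. Every edge of an $st$-path $p$ in $G^\star_{st}$ other than its first and last edge is dual to a primal edge $e=uv$ of $G$, and $p$ is said to cross $e$; the endpoint of $e$ lying locally to the left of $p$ when traversing this dual edge is called left of it, the other endpoint right of it. A labeling of $G$ is a map $l\colon V\to\{L,R\}$. A path $p$ is compatible with $l$ if for every primal edge $uv$ crossed by $p$ with $u$ left and $v$ right of the crossing dual edge, $l(u)=L$ and $l(v)=R$. A path is consistent if some labeling of $G$ is compatible with it. The length of a path is its number of edges. -}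

module Defs where

open import Data.Nat using (ℕ; zero; suc; _+_; _*_; _≤_)
open import Data.Fin using (Fin; _≟_)
open import Data.List using (List; []; _∷_; length; filter; allFin)
open import Data.List.Relation.Unary.All using (All)
open import Data.List.Relation.Unary.Unique.Propositional using (Unique)
open import Data.Product using (Σ; ∃; ∃-syntax; _×_; _,_)
open import Relation.Binary.PropositionalEquality using (_≡_; _≢_)
open import Relation.Binary.Construct.Closure.ReflexiveTransitive using (Star)
open import Relation.Nullary using (¬_)
open import Function.Bundles using (_⇔_)

iter : ∀ {A : Set} → (A → A) → ℕ → A → A
iter f zero    x = x
iter f (suc k) x = f (iter f k x)

-- A connected simple graph with a fixed combinatorial embedding
-- (rotation system), given as a combinatorial map on the set of darts
-- Fin (2 * nE).  Dart d goes from vertex `vert d` to vertex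
-- `vert (α d)`; α is the dart reversal, σ the rotation of darts around
-- their tail vertex.  Faces are the orbits of φ = σ ∘ α; `face d` is
-- the face traced by d (the face on one fixed side of d, say right,
-- when σ is counterclockwise).  The embedding is planar (genus 0) iff Euler's formula
-- V - E + F = 2 holds.
record PlaneGraph : Set where
  field
    nV nE nF : ℕ
    α σ σ⁻¹  : Fin (2 * nE) → Fin (2 * nE)
    α-invol  : ∀ d → α (α d) ≡ d
    α-free   : ∀ d → α d ≢ d
    σσ⁻¹     : ∀ d → σ (σ⁻¹ d) ≡ d
    σ⁻¹σ     : ∀ d → σ⁻¹ (σ d) ≡ d
    vert     : Fin (2 * nE) → Fin nV
    vert-orb : ∀ d d′ → (vert d ≡ vert d′) ⇔ (∃[ k ] iter σ k d ≡ d′)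
    vert-sur : ∀ v → ∃[ d ] vert d ≡ v
    face     : Fin (2 * nE) → Fin nF
    face-orb : ∀ d d′ → (face d ≡ face d′) ⇔ (∃[ k ] iter (λ x → σ (α x)) k d ≡ d′)
    face-sur : ∀ f → ∃[ d ] face d ≡ f
    no-loop  : ∀ d → vert d ≢ vert (α d)
    no-multi : ∀ d d′ → vert d ≡ vert d′ → vert (α d) ≡ vert (α d′) → d ≡ d′
    connected : ∀ u v → Star (λ x y → ∃[ d ] (vert d ≡ x × vert (α d) ≡ y)) u v
    euler    : nV + nF ≡ nE + 2

module _ (G : PlaneGraph) where
  open PlaneGraph G

  Dart : Set
  Dart = Fin (2 * nE)

  degree : Fin nV → ℕ
  degree v = length (filter (λ d → vert d ≟ v) (allFin (2 * nE)))

  Adjacent : Fin nV → Fin nV → Set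
  Adjacent u v = ∃[ d ] (vert d ≡ u × vert (α d) ≡ v)

  Incident : Fin nV → Fin nF → Set
  Incident v f = ∃[ d ] (vert d ≡ v × face d ≡ f)

  -- A walk in the dual G⋆ from face f to face g: each step crosses the
  -- primal edge of dart d, moving from face d to face (α d).  For this
  -- dual edge, vert d is the endpoint left of the crossing and
  -- vert (α d) the endpoint right of it.
  data DWalk : Fin nF → Fin nF → Set where
    stop : ∀ f → DWalk f f
    step : ∀ {g} (d : Dart) → DWalk (face (α d)) g → DWalk (face d) g

  visited : ∀ {f g} → DWalk f g → List (Fin nF)
  visited (stop f)   = f ∷ []
  visited (step {g} d w) = face d ∷ visited w

  crossed : ∀ {f g} → DWalk f g → List Dart
  crossed (stop f)   = []
  crossed (step d w) = d ∷ crossed w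

  -- An st-path in the extended dual G⋆_st (s t vertices of G):
  -- s — f₀ — ... — f_k — t, where the dual vertices (faces) are
  -- pairwise distinct, s is joined to f₀ (f₀ incident to s) and
  -- f_k to t.  (There is no direct s–t edge in G⋆_st.)
  record STPath (s t : Fin nV) : Set where
    field
      first last : Fin nF
      walk       : DWalk first last
      s-inc      : Incident s first
      t-inc      : Incident t last
      simple     : Unique (visited walk)

  -- number of edges of the path: the two edges at s and t plus the
  -- dual edges crossed
  pathLength : ∀ {s t} → STPath s t → ℕ
  pathLength p = 2 + length (crossed (STPath.walk p))

  Shortest : ∀ {s t} → STPath s t → Set
  Shortest {s} {t} p = ∀ (q : STPath s t) → pathLength p ≤ pathLength q

  data Side : Set where
    L R : Side

  Labeling : Set
  Labeling = Fin nV → Side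

  Compatible : ∀ {s t} → Labeling → STPath s t → Set
  Compatible l p =
    All (λ d → l (vert d) ≡ L × l (vert (α d)) ≡ R) (crossed (STPath.walk p))

  Consistent : ∀ {s t} → STPath s t → Set
  Consistent p = ∃[ l ] Compatible l p

-- Label a vertex L exactly when it is the left endpoint of some edge crossed by the path.
-- This labeling is compatible unless some vertex v is the left endpoint of one crossed edge
-- and the right endpoint of another.  Then the path leaves a face around v and, at least two
-- crossings later, enters a face around v again.  Since v has degree at most 3, any two faces
-- around v coincide or share an edge of v, so the path could go directly from the first of
-- these faces to the second, contradicting minimality.
module Submission where

open import Defs
open import Data.Nat using (ℕ; zero; suc; _+_; _∸_; _*_; _≤_; _<_; s≤s; z≤n; s≤s⁻¹)
open import Data.Nat.Properties
  using (≤-trans; ≤-refl; n≤1+n; <⇒≱; <-cmp; +-comm; m∸n+n≡m; m∸n≤m; m<n⇒0<n∸m; <⇒≤; 1+n≰n)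
open import Data.Fin using (Fin; _≟_; toℕ; fromℕ<)
open import Data.Fin.Properties using (any?; injective⇒≤; toℕ-injective; toℕ<n; toℕ≤pred[n]; toℕ-fromℕ<)
open import Data.List using (List; []; _∷_; length; filter; allFin; lookup)
open import Data.List.Relation.Unary.All using (tabulate)
open import Data.List.Relation.Unary.Any using (Any; here; there; index)
import Data.List.Relation.Unary.Any as Any
open import Data.List.Relation.Unary.Any.Properties using (lookup-index)
open import Data.List.Relation.Unary.AllPairs using ([]; _∷_)
open import Data.List.Relation.Unary.Unique.Propositional using (Unique)
open import Data.List.Relation.Binary.Sublist.Propositional using (_⊆_; []; _∷_; _∷ʳ_; ⊆-refl; ⊆-trans)
open import Data.List.Relation.Binary.Sublist.Propositional.Properties using (All-resp-⊆)
open import Data.List.Membership.Propositional using (_∈_)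
open import Data.List.Membership.Propositional.Properties using (∈-filter⁺; ∈-allFin)
open import Data.Bool using (if_then_else_)
open import Data.Product using (Σ; ∃-syntax; _×_; _,_; proj₁; proj₂)
open import Data.Sum using (_⊎_; inj₁; inj₂)
open import Function using (_∘_)
open import Function.Definitions using (Injective)
open import Function.Bundles using (Equivalence)
open import Relation.Binary using (tri<; tri≈; tri>)
open import Relation.Binary.PropositionalEquality using (_≡_; _≢_; refl; sym; trans; cong; subst; module ≡-Reasoning)
open import Relation.Nullary using (¬_; yes; no; does; contradiction)

Unique-resp-⊇ : ∀ {A : Set} {xs ys : List A} → xs ⊆ ys → Unique ys → Unique xs
Unique-resp-⊇ []           _        = []
Unique-resp-⊇ (y ∷ʳ xs⊆)   (_ ∷ u)  = Unique-resp-⊇ xs⊆ u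
Unique-resp-⊇ (refl ∷ xs⊆) (x∉ ∷ u) = All-resp-⊆ xs⊆ x∉ ∷ Unique-resp-⊇ xs⊆ u

module _ {A : Set} {f : A → A} where

  iter-+ : ∀ m n x → iter f (m + n) x ≡ iter f m (iter f n x)
  iter-+ zero    n x = refl
  iter-+ (suc m) n x = cong f (iter-+ m n x)

  module _ (f-injective : Injective _≡_ _≡_ f) where

    iter-injective : ∀ k → Injective _≡_ _≡_ (iter f k)
    iter-injective zero    e = e
    iter-injective (suc k) e = iter-injective k (f-injective e)

    iter-cancel : ∀ i k x → iter f i x ≡ iter f (k + i) x → iter f k x ≡ x
    iter-cancel i k x e = sym (iter-injective i (begin
      iter f i x             ≡⟨ e ⟩
      iter f (k + i) x       ≡⟨ cong (λ n → iter f n x) (+-comm k i) ⟩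
      iter f (i + k) x       ≡⟨ iter-+ i k x ⟩
      iter f i (iter f k x)  ∎))
      where open ≡-Reasoning

    orbit-no-repeat : ∀ {n a b} x → (∀ k → 0 < k → k ≤ n → iter f k x ≢ x) →
                      a < b → b ≤ n → iter f a x ≢ iter f b x
    orbit-no-repeat {a = a} {b = b} x aperiodic a<b b≤n e =
      aperiodic (b ∸ a) (m<n⇒0<n∸m a<b) (≤-trans (m∸n≤m b a) b≤n)
        (iter-cancel a (b ∸ a) x (trans e (cong (λ m → iter f m x) (sym (m∸n+n≡m (<⇒≤ a<b))))))

    orbit-injective : ∀ {n} x → (∀ k → 0 < k → k ≤ n → iter f k x ≢ x) →
                      Injective _≡_ _≡_ (λ (i : Fin (suc n)) → iter f (toℕ i) x)
    orbit-injective x aperiodic {i} {j} e with <-cmp (toℕ i) (toℕ j)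
    ... | tri< i<j _ _ = contradiction e (orbit-no-repeat x aperiodic i<j (toℕ≤pred[n] j))
    ... | tri≈ _ i≡j _ = toℕ-injective i≡j
    ... | tri> _ _ j<i = contradiction (sym e) (orbit-no-repeat x aperiodic j<i (toℕ≤pred[n] i))

module _ (G : PlaneGraph) where
  open PlaneGraph G

  vert-σ : ∀ x → vert (σ x) ≡ vert x
  vert-σ x = sym (Equivalence.from (vert-orb x (σ x)) (1 , refl))

  vert-iter-σ : ∀ k x → vert (iter σ k x) ≡ vert x
  vert-iter-σ zero    x = refl
  vert-iter-σ (suc k) x = trans (vert-σ (iter σ k x)) (vert-iter-σ k x)

  face-φ : ∀ x → face (σ (α x)) ≡ face x
  face-φ x = sym (Equivalence.from (face-orb x (σ (α x))) (1 , refl))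

  face-α : ∀ x → face (α x) ≡ face (σ x)
  face-α x = Equivalence.from (face-orb (α x) (σ x)) (1 , cong σ (α-invol x))

  σ-injective : Injective _≡_ _≡_ σ
  σ-injective {a} {b} e = trans (sym (σ⁻¹σ a)) (trans (cong σ⁻¹ e) (σ⁻¹σ b))

  injective-darts-at⇒≤degree : ∀ {k v} (ds : Fin k → Dart G) → Injective _≡_ _≡_ ds →
                                (∀ i → vert (ds i) ≡ v) → k ≤ degree G v
  injective-darts-at⇒≤degree {v = v} ds ds-injective at-v = injective⇒≤ position-injective
    where
    darts-at-v : List (Dart G)
    darts-at-v = filter (λ d → vert d ≟ v) (allFin (2 * nE))
    member : ∀ i → ds i ∈ darts-at-v
    member i = ∈-filter⁺ (λ d → vert d ≟ v) (∈-allFin (ds i)) (at-v i)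
    position-injective : Injective _≡_ _≡_ (λ i → index (member i))
    position-injective {i} {j} e =
      ds-injective (trans (lookup-index (member i)) (trans (cong (lookup darts-at-v) e) (sym (lookup-index (member j)))))

  σ-period≤degree : ∀ x → ∃[ k ] (0 < k × k ≤ degree G (vert x) × iter σ k x ≡ x)
  σ-period≤degree x with any? (λ (i : Fin (degree G (vert x))) → iter σ (suc (toℕ i)) x ≟ x)
  ... | yes (i , period) = suc (toℕ i) , s≤s z≤n , toℕ<n i , period
  ... | no no-period = contradiction orbit-fits 1+n≰n
    where
    aperiodic : ∀ k → 0 < k → k ≤ degree G (vert x) → iter σ k x ≢ x
    aperiodic (suc k) _ k<deg period =
      no-period (fromℕ< k<deg , subst (λ m → iter σ (suc m) x ≡ x) (sym (toℕ-fromℕ< k<deg)) period)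
    orbit-fits : suc (degree G (vert x)) ≤ degree G (vert x)
    orbit-fits = injective-darts-at⇒≤degree (λ i → iter σ (toℕ i) x)
                   (orbit-injective σ-injective x aperiodic) (λ i → vert-iter-σ (toℕ i) x)

  σ-cycle≤3 : ∀ x → degree G (vert x) ≤ 3 → σ x ≡ x ⊎ σ (σ x) ≡ x ⊎ σ (σ (σ x)) ≡ x
  σ-cycle≤3 x deg≤3 with σ-period≤degree x
  ... | 1 , _ , _ , period = inj₁ period
  ... | 2 , _ , _ , period = inj₂ (inj₁ period)
  ... | 3 , _ , _ , period = inj₂ (inj₂ period)
  ... | suc (suc (suc (suc _))) , _ , 4≤deg , _ = contradiction (≤-trans 4≤deg deg≤3) λ { (s≤s (s≤s (s≤s ()))) }

  darts-at-degree≤3 : ∀ {x y} → degree G (vert x) ≤ 3 → vert x ≡ vert y → y ≡ x ⊎ y ≡ σ x ⊎ x ≡ σ y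
  darts-at-degree≤3 {x} deg≤3 same-vertex with Equivalence.to (vert-orb x _) same-vertex
  ... | k , refl = orbit-near k
    where
    Near : Dart G → Set
    Near z = z ≡ x ⊎ z ≡ σ x ⊎ x ≡ σ z
    σ-closed : ∀ z → Near z → Near (σ z)
    σ-closed _ (inj₁ refl) = inj₂ (inj₁ refl)
    σ-closed _ (inj₂ (inj₁ refl)) with σ-cycle≤3 x deg≤3
    ... | inj₁ period = inj₂ (inj₁ (cong σ period))
    ... | inj₂ (inj₁ period) = inj₁ period
    ... | inj₂ (inj₂ period) = inj₂ (inj₂ (sym period))
    σ-closed _ (inj₂ (inj₂ x≡σz)) = inj₁ (sym x≡σz)
    orbit-near : ∀ k → Near (iter σ k x)
    orbit-near zero    = inj₁ refl
    orbit-near (suc k) = σ-closed _ (orbit-near k)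

  DualEdge : Fin nF → Fin nF → Set
  DualEdge f g = ∃[ d ] (face d ≡ f × face (α d) ≡ g)

  faces-at-degree≤3 : ∀ {v f g} → degree G v ≤ 3 → Incident G v f → Incident G v g → f ≡ g ⊎ DualEdge f g
  faces-at-degree≤3 deg≤3 (x , refl , refl) (y , y-at-v , refl) with darts-at-degree≤3 deg≤3 (sym y-at-v)
  ... | inj₁ refl        = inj₁ refl
  ... | inj₂ (inj₁ refl) = inj₂ (x , refl , face-α x)
  ... | inj₂ (inj₂ refl) = inj₂ (α y , face-α y , cong face (α-invol y))

  tail-faces-incident : ∀ {v} d → vert d ≡ v → Incident G v (face d) × Incident G v (face (α d))
  tail-faces-incident d d-at-v = (d , d-at-v , refl) , (σ d , trans (vert-σ d) d-at-v , sym (face-α d))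

  head-faces-incident : ∀ {v} d → vert (α d) ≡ v → Incident G v (face d) × Incident G v (face (α d))
  head-faces-incident d αd-at-v = (σ (α d) , trans (vert-σ (α d)) αd-at-v , face-φ d) , (α d , αd-at-v , refl)

  walkLength : ∀ {f g} → DWalk G f g → ℕ
  walkLength w = length (crossed G w)

  _≺_ : ∀ {f g f′ g′} → DWalk G f g → DWalk G f′ g′ → Set
  u ≺ w = walkLength u < walkLength w × visited G u ⊆ visited G w

  module _ (P : Fin nF → Set) where

    data Reaches : ∀ {f g} → DWalk G f g → Set where
      here  : ∀ {d g} {w : DWalk G (face (α d)) g} → P (face (α d)) → Reaches (step d w)
      there : ∀ {d g} {w : DWalk G (face (α d)) g} → Reaches w → Reaches (step d w)

    data Detour : ∀ {f g} → DWalk G f g → Set where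
      here  : ∀ {d g} {w : DWalk G (face (α d)) g} → P (face d) → Reaches w → Detour (step d w)
      there : ∀ {d g} {w : DWalk G (face (α d)) g} → Detour w → Detour (step d w)

    reached-suffix : ∀ {f g} {w : DWalk G f g} → Reaches w → ∃[ y ] (P y × Σ (DWalk G y g) (_≺ w))
    reached-suffix (here {d} {w = w} Py) = _ , Py , w , ≤-refl , (face d ∷ʳ ⊆-refl)
    reached-suffix (there {d} r) with reached-suffix r
    ... | y , Py , u , shorter , u⊆w = y , Py , u , ≤-trans shorter (n≤1+n _) , (face d ∷ʳ u⊆w)

    prepend : ∀ {f y g} → f ≡ y ⊎ DualEdge f y → (u : DWalk G y g) →
              Σ (DWalk G f g) λ w → walkLength w ≤ suc (walkLength u) × visited G w ⊆ f ∷ visited G u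
    prepend (inj₁ refl)              u = u , n≤1+n _ , (_ ∷ʳ ⊆-refl)
    prepend (inj₂ (d , refl , refl)) u = step d u , ≤-refl , ⊆-refl

    -- The two P-faces of a detour are joined directly, replacing at least two crossings by at most one.
    shortcut : (∀ {f g} → P f → P g → f ≡ g ⊎ DualEdge f g) →
               ∀ {f g} {w : DWalk G f g} → Detour w → Σ (DWalk G f g) (_≺ w)
    shortcut near (here Pf r) with reached-suffix r
    ... | y , Py , u , shorter , u⊆w with prepend (near Pf Py) u
    ... | w′ , w′≤ , w′⊆ = w′ , s≤s (≤-trans w′≤ shorter) , ⊆-trans w′⊆ (refl ∷ u⊆w)
    shortcut near (there detour) with shortcut near detour
    ... | w′ , shorter , w′⊆w = step _ w′ , s≤s shorter , (refl ∷ w′⊆w)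

    reaches : ∀ {Q : Dart G → Set} → (∀ d → Q d → P (face (α d))) →
              ∀ {f g} (w : DWalk G f g) → Any Q (crossed G w) → Reaches w
    reaches QP (step d w) (here Qd)  = here (QP d Qd)
    reaches QP (step d w) (there Qw) = there (reaches QP w Qw)

  endpoint-on-both-sides⇒detour :
    ∀ {v f g} (w : DWalk G f g) →
    Any (λ d → vert d ≡ v) (crossed G w) → Any (λ d → vert (α d) ≡ v) (crossed G w) → Detour (Incident G v) w
  endpoint-on-both-sides⇒detour (step d w) (here d-at-v) (here αd-at-v) =
    contradiction (trans d-at-v (sym αd-at-v)) (no-loop d)
  endpoint-on-both-sides⇒detour (step d w) (here d-at-v) (there αds) =
    here (proj₁ (tail-faces-incident d d-at-v)) (reaches _ (λ e → proj₂ ∘ head-faces-incident e) w αds)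
  endpoint-on-both-sides⇒detour (step d w) (there ds) (here αd-at-v) =
    here (proj₁ (head-faces-incident d αd-at-v)) (reaches _ (λ e → proj₂ ∘ tail-faces-incident e) w ds)
  endpoint-on-both-sides⇒detour (step d w) (there ds) (there αds) =
    there (endpoint-on-both-sides⇒detour w ds αds)

  module _ {s t} (p : STPath G s t) where
    open STPath p

    LeftOf RightOf : Fin nV → Set
    LeftOf  v = Any (λ d → vert d ≡ v) (crossed G walk)
    RightOf v = Any (λ d → vert (α d) ≡ v) (crossed G walk)

    shortcut⇒not-shortest : (w : DWalk G first last) → w ≺ walk → ¬ Shortest G p
    shortcut⇒not-shortest w (shorter , w⊆walk) shortest = <⇒≱ shorter (s≤s⁻¹ (s≤s⁻¹ (shortest q)))
      where
      q : STPath G s t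
      q = record { walk = w ; s-inc = s-inc ; t-inc = t-inc ; simple = Unique-resp-⊇ w⊆walk simple }

    shortest⇒not-left-and-right : ∀ {v} → degree G v ≤ 3 → Shortest G p → LeftOf v → ¬ RightOf v
    shortest⇒not-left-and-right deg≤3 shortest left right with
      shortcut _ (faces-at-degree≤3 deg≤3) (endpoint-on-both-sides⇒detour walk left right)
    ... | w , w≺walk = shortcut⇒not-shortest w w≺walk shortest

    not-left-and-right⇒consistent : (∀ v → LeftOf v → ¬ RightOf v) → Consistent G p
    not-left-and-right⇒consistent one-sided = labeling , tabulate compatible
      where
      labeling : Labeling G
      labeling u = if does (Any.any? (λ d → vert d ≟ u) (crossed G walk)) then L else R
      compatible : ∀ {d} → d ∈ crossed G walk → labeling (vert d) ≡ L × labeling (vert (α d)) ≡ R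
      compatible {d} d∈walk = left , right
        where
        left : labeling (vert d) ≡ L
        left with Any.any? (λ d′ → vert d′ ≟ vert d) (crossed G walk)
        ... | yes _    = refl
        ... | no ¬left = contradiction (Any.map (cong vert ∘ sym) d∈walk) ¬left
        right : labeling (vert (α d)) ≡ R
        right with Any.any? (λ d′ → vert d′ ≟ vert (α d)) (crossed G walk)
        ... | yes left = contradiction (Any.map (cong (vert ∘ α) ∘ sym) d∈walk) (one-sided _ left)
        ... | no _     = refl

theorem1 : (G : PlaneGraph) →
    (∀ v → degree G v ≤ 3) →
    (s t : Fin (PlaneGraph.nV G)) → s ≢ t → ¬ Adjacent G s t →
    (p : STPath G s t) → Shortest G p → Consistent G p
theorem1 G deg s t _ _ p shortest =
  not-left-and-right⇒consistent G p (λ v → shortest⇒not-left-and-right G p (deg v) shortest)
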